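{- Let $x$ be a sequence of pairwise distinct integers of length $m$, $i\in\{1,\ldots,m-1\}$ and $y=\tau(x,i)$. Define $r=\overleftarrow{PD}_x[i]$ if $x[i]<x[i+1]$ and $\overleftarrow{PD}_x[i]>1$; $r=\overleftarrow{PD}_x[i+1]+1$ if $x[i]>x[i+1]$ and $\overleftarrow{PD}_x[i+1]>0$; and $r=m-i+1$ otherwise. Define $\ell=\overrightarrow{PD}_x[i]$ if $x[i]<x[i+1]$ and $\overrightarrow{PD}_x[i]>0$; $\ell=\overrightarrow{PD}_x[i+1]-1$ if $x[i]>x[i+1]$ and $\overrightarrow{PD}_x[i+1]>1$; and $\ell=i$ otherwise. Then $\overrightarrow{PD}_x[k]=\overrightarrow{PD}_y[k]$ for all $i+r\le k\le m$, and $\overleftarrow{PD}_x[k]=\overleftarrow{PD}_y[k]$ for all $1\le k\le i-\ell$.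
   Context: All sequences consist of pairwise distinct integers. $\tau(x,i)$ exchanges $x[i]$ and $x[i+1]$. $\overrightarrow{PD}_x[h]=h-\max\{j<h: x[j]<x[h]\}$ if such $j$ exists and $0$ otherwise; $\overleftarrow{PD}_x[h]=\min\{j>h: x[j]<x[h]\}-h$ if such $j$ exists and $0$ otherwise. -}

module Defs where

open import Data.Nat using (ℕ; zero; suc; _+_; _∸_; _≤_; _<_; _≟_)
import Data.Nat
open import Data.Integer using (ℤ) renaming (_<_ to _<ℤ_)
open import Data.Integer.Properties using () renaming (_<?_ to _<ℤ?_)
open import Data.Maybe using (Maybe; just; nothing)
open import Relation.Nullary using (yes; no; ¬_)
open import Relation.Binary.PropositionalEquality using (_≡_)

-- A sequence of length m is a function x : ℕ → ℤ of which only the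
-- entries x 1, ..., x m (1-indexed, as in the paper) are relevant.

Distinct : ℕ → (ℕ → ℤ) → Set
Distinct m x = ∀ a b → 1 ≤ a → a ≤ m → 1 ≤ b → b ≤ m → x a ≡ x b → a ≡ b

τ : (ℕ → ℤ) → ℕ → (ℕ → ℤ)
τ x i k with k ≟ i
... | yes _ = x (suc i)
... | no _ with k ≟ suc i
...   | yes _ = x i
...   | no _ = x k

lastBelow : (ℕ → ℤ) → ℤ → ℕ → Maybe ℕ
lastBelow x v zero = nothing
lastBelow x v (suc n) with x (suc n) <ℤ? v
... | yes _ = just (suc n)
... | no _ = lastBelow x v n

firstBelow : (ℕ → ℤ) → ℤ → (s c : ℕ) → Maybe ℕ
firstBelow x v s zero = nothing
firstBelow x v s (suc c) with x s <ℤ? v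
... | yes _ = just s
... | no _ = firstBelow x v (suc s) c

PDfwd : (ℕ → ℤ) → ℕ → ℕ
PDfwd x h with lastBelow x (x h) (h ∸ 1)
... | just j = h ∸ j
... | nothing = 0

PDbwd : ℕ → (ℕ → ℤ) → ℕ → ℕ
PDbwd m x h with firstBelow x (x h) (suc h) (m ∸ h)
... | just j = j ∸ h
... | nothing = 0

rOf : ℕ → (ℕ → ℤ) → ℕ → ℕ
rOf m x i with x i <ℤ? x (suc i)
... | yes _ with 1 Data.Nat.<? PDbwd m x i
...   | yes _ = PDbwd m x i
...   | no _ = m ∸ i + 1
rOf m x i | no _ with x (suc i) <ℤ? x i | 0 Data.Nat.<? PDbwd m x (suc i)
... | yes _ | yes _ = PDbwd m x (suc i) + 1
... | _ | _ = m ∸ i + 1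

ℓOf : (ℕ → ℤ) → ℕ → ℕ
ℓOf x i with x i <ℤ? x (suc i)
... | yes _ with 0 Data.Nat.<? PDfwd x i
...   | yes _ = PDfwd x i
...   | no _ = i
ℓOf x i | no _ with x (suc i) <ℤ? x i | 1 Data.Nat.<? PDfwd x (suc i)
... | yes _ | yes _ = PDfwd x (suc i) ∸ 1
... | _ | _ = i

{-# OPTIONS --safe #-}
-- Fix k and v = x[k].  Both PD values at k only ask which positions carry an
-- entry below v, and the swap τ(x,i) changes that pattern only when exactly one
-- of x[i], x[i+1] is below v.  The position i + r (resp. i − ℓ) carries an entry
-- below both x[i] and x[i+1]; in the "exactly one" case that entry is below v
-- as well, and it lies between k and the swapped pair, so the search for the
-- nearest smaller entry stops there before reaching positions i and i + 1.
module Submission where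

open import Defs
open import Data.Nat using (ℕ; zero; suc; _+_; _∸_; _≤_; _<_; s≤s; z<s; _≟_)
import Data.Nat as ℕ
open import Data.Nat.Properties hiding (_≟_)
open import Data.Integer using (ℤ) renaming (_<_ to _<ℤ_)
open import Data.Integer.Properties using () renaming (_<?_ to _<ℤ?_; <-trans to <ℤ-trans; <-irrefl to <ℤ-irrefl)
open import Data.Maybe using (just; nothing; maybe′)
open import Data.Product using (_×_; _,_)
open import Data.Sum using (_⊎_; inj₁; inj₂)
open import Function.Bundles using (_⇔_; mk⇔; Equivalence)
open import Function.Construct.Identity using (⇔-id)
open import Function.Construct.Symmetry using (⇔-sym)
open import Relation.Nullary using (yes; no; contradiction)
open import Relation.Binary.PropositionalEquality

SameSide : ℤ → ℤ → ℤ → Set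
SameSide v a b = a <ℤ v ⇔ b <ℤ v

SameSide-≡ : ∀ {v a b} → a ≡ b → SameSide v a b
SameSide-≡ refl = ⇔-id _

sameSide⊎below : ∀ v {a b w} → w <ℤ a → w <ℤ b → SameSide v a b ⊎ w <ℤ v
sameSide⊎below v {a} {b} w<a w<b with a <ℤ? v | b <ℤ? v
... | yes a<v | yes b<v = inj₁ (mk⇔ (λ _ → b<v) (λ _ → a<v))
... | no  a≮v | no  b≮v = inj₁ (mk⇔ (λ a<v → contradiction a<v a≮v) (λ b<v → contradiction b<v b≮v))
... | yes a<v | no  _   = inj₂ (<ℤ-trans w<a a<v)
... | no  _   | yes b<v = inj₂ (<ℤ-trans w<b b<v)

m∸n<m : ∀ m n → 0 < m → 0 < n → m ∸ n < m
m∸n<m (suc m) (suc n) _ _ = s≤s (m∸n≤m m n)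

τ-unchanged : ∀ x i {j} → j ≢ i → j ≢ suc i → τ x i j ≡ x j
τ-unchanged x i {j} j≢i j≢1+i with j ≟ i
... | yes j≡i = contradiction j≡i j≢i
... | no _ with j ≟ suc i
...   | yes j≡1+i = contradiction j≡1+i j≢1+i
...   | no _ = refl

τ-below : ∀ x i {j} → j < i → τ x i j ≡ x j
τ-below x i j<i = τ-unchanged x i (<⇒≢ j<i) (<⇒≢ (m<n⇒m<1+n j<i))

τ-above : ∀ x i {j} → suc i < j → τ x i j ≡ x j
τ-above x i 1+i<j = τ-unchanged x i (>⇒≢ (<-trans (n<1+n i) 1+i<j)) (>⇒≢ 1+i<j)

τ-sameSide : ∀ x i {v} → SameSide v (x i) (x (suc i)) → ∀ j → SameSide v (x j) (τ x i j)
τ-sameSide x i same j with j ≟ i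
... | yes refl = same
... | no _ with j ≟ suc i
...   | yes refl = ⇔-sym same
...   | no _ = ⇔-id _

module _ (x : ℕ → ℤ) (v : ℤ) where

  lastBelow-here : ∀ {n} → x (suc n) <ℤ v → lastBelow x v (suc n) ≡ just (suc n)
  lastBelow-here {n} x<v with x (suc n) <ℤ? v
  ... | yes _ = refl
  ... | no x≮v = contradiction x<v x≮v

  firstBelow-here : ∀ {s c} → x s <ℤ v → firstBelow x v s (suc c) ≡ just s
  firstBelow-here {s} x<v with x s <ℤ? v
  ... | yes _ = refl
  ... | no x≮v = contradiction x<v x≮v

module _ (x y : ℕ → ℤ) (v : ℤ) where

  lastBelow-step : ∀ {n} → SameSide v (x (suc n)) (y (suc n)) →
    lastBelow x v n ≡ lastBelow y v n → lastBelow x v (suc n) ≡ lastBelow y v (suc n)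
  lastBelow-step {n} same eq with x (suc n) <ℤ? v | y (suc n) <ℤ? v
  ... | yes _   | yes _   = refl
  ... | no  _   | no  _   = eq
  ... | yes x<v | no  y≮v = contradiction (Equivalence.to same x<v) y≮v
  ... | no  x≮v | yes y<v = contradiction (Equivalence.from same y<v) x≮v

  lastBelow-cong : ∀ n → (∀ q → q ≤ n → SameSide v (x q) (y q)) → lastBelow x v n ≡ lastBelow y v n
  lastBelow-cong zero    _    = refl
  lastBelow-cong (suc n) same =
    lastBelow-step (same (suc n) ≤-refl) (lastBelow-cong n (λ q q≤n → same q (m≤n⇒m≤1+n q≤n)))

  lastBelow-hit : ∀ {j} n → j ≤ n → (∀ q → j < q → q ≤ n → SameSide v (x q) (y q)) →
    x j <ℤ v → y j <ℤ v → lastBelow x v n ≡ lastBelow y v n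
  lastBelow-hit zero    _   _    _   _   = refl
  lastBelow-hit (suc n) j≤n same x<v y<v with m≤n⇒m<n∨m≡n j≤n
  ... | inj₂ refl = trans (lastBelow-here x v x<v) (sym (lastBelow-here y v y<v))
  ... | inj₁ j<n  = lastBelow-step (same (suc n) j<n ≤-refl)
    (lastBelow-hit n (<⇒≤pred j<n) (λ q j<q q≤n → same q j<q (m≤n⇒m≤1+n q≤n)) x<v y<v)

  firstBelow-step : ∀ {s c} → SameSide v (x s) (y s) →
    firstBelow x v (suc s) c ≡ firstBelow y v (suc s) c → firstBelow x v s (suc c) ≡ firstBelow y v s (suc c)
  firstBelow-step {s} same eq with x s <ℤ? v | y s <ℤ? v
  ... | yes _   | yes _   = refl
  ... | no  _   | no  _   = eq
  ... | yes x<v | no  y≮v = contradiction (Equivalence.to same x<v) y≮v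
  ... | no  x≮v | yes y<v = contradiction (Equivalence.from same y<v) x≮v

  firstBelow-cong : ∀ s c → (∀ q → s ≤ q → SameSide v (x q) (y q)) → firstBelow x v s c ≡ firstBelow y v s c
  firstBelow-cong s zero    _    = refl
  firstBelow-cong s (suc c) same =
    firstBelow-step (same s ≤-refl) (firstBelow-cong (suc s) c (λ q s<q → same q (<⇒≤ s<q)))

  firstBelow-hit : ∀ {j} s c → s ≤ j → (∀ q → s ≤ q → q < j → SameSide v (x q) (y q)) →
    x j <ℤ v → y j <ℤ v → firstBelow x v s c ≡ firstBelow y v s c
  firstBelow-hit s zero    _   _    _   _   = refl
  firstBelow-hit s (suc c) s≤j same x<v y<v with m≤n⇒m<n∨m≡n s≤j
  ... | inj₂ refl = trans (firstBelow-here x v x<v) (sym (firstBelow-here y v y<v))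
  ... | inj₁ s<j  = firstBelow-step (same s ≤-refl s<j)
    (firstBelow-hit (suc s) c s<j (λ q s<q q<j → same q (<⇒≤ s<q) q<j) x<v y<v)

lastBelow-sound : ∀ x v n {j} → lastBelow x v n ≡ just j → x j <ℤ v × j ≤ n
lastBelow-sound x v (suc n) eq with x (suc n) <ℤ? v
lastBelow-sound x v (suc n) refl | yes x<v = x<v , ≤-refl
... | no _ with lastBelow-sound x v n eq
...   | x<v , j≤n = x<v , m≤n⇒m≤1+n j≤n

firstBelow-sound : ∀ x v s c {j} → firstBelow x v s c ≡ just j → x j <ℤ v × s ≤ j
firstBelow-sound x v s (suc c) eq with x s <ℤ? v
firstBelow-sound x v s (suc c) refl | yes x<v = x<v , ≤-refl
... | no _ with firstBelow-sound x v (suc s) c eq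
...   | x<v , s<j = x<v , <⇒≤ s<j

PDfwd-unfold : ∀ x h → PDfwd x h ≡ maybe′ (h ∸_) 0 (lastBelow x (x h) (h ∸ 1))
PDfwd-unfold x h with lastBelow x (x h) (h ∸ 1)
... | just _  = refl
... | nothing = refl

PDbwd-unfold : ∀ m x h → PDbwd m x h ≡ maybe′ (_∸ h) 0 (firstBelow x (x h) (suc h) (m ∸ h))
PDbwd-unfold m x h with firstBelow x (x h) (suc h) (m ∸ h)
... | just _  = refl
... | nothing = refl

PDfwd-cong : ∀ x y h → x h ≡ y h →
  lastBelow x (x h) (h ∸ 1) ≡ lastBelow y (x h) (h ∸ 1) → PDfwd x h ≡ PDfwd y h
PDfwd-cong x y h xh≡yh eq = begin
  PDfwd x h                                        ≡⟨ PDfwd-unfold x h ⟩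
  maybe′ (h ∸_) 0 (lastBelow x (x h) (h ∸ 1))      ≡⟨ cong (maybe′ (h ∸_) 0) eq ⟩
  maybe′ (h ∸_) 0 (lastBelow y (x h) (h ∸ 1))      ≡⟨ cong (λ v → maybe′ (h ∸_) 0 (lastBelow y v (h ∸ 1))) xh≡yh ⟩
  maybe′ (h ∸_) 0 (lastBelow y (y h) (h ∸ 1))      ≡⟨ PDfwd-unfold y h ⟨
  PDfwd y h                                        ∎
  where open ≡-Reasoning

PDbwd-cong : ∀ m x y h → x h ≡ y h →
  firstBelow x (x h) (suc h) (m ∸ h) ≡ firstBelow y (x h) (suc h) (m ∸ h) → PDbwd m x h ≡ PDbwd m y h
PDbwd-cong m x y h xh≡yh eq = begin
  PDbwd m x h                                              ≡⟨ PDbwd-unfold m x h ⟩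
  maybe′ (_∸ h) 0 (firstBelow x (x h) (suc h) (m ∸ h))     ≡⟨ cong (maybe′ (_∸ h) 0) eq ⟩
  maybe′ (_∸ h) 0 (firstBelow y (x h) (suc h) (m ∸ h))     ≡⟨ cong (λ v → maybe′ (_∸ h) 0 (firstBelow y v (suc h) (m ∸ h))) xh≡yh ⟩
  maybe′ (_∸ h) 0 (firstBelow y (y h) (suc h) (m ∸ h))     ≡⟨ PDbwd-unfold m y h ⟨
  PDbwd m y h                                              ∎
  where open ≡-Reasoning

PDfwd-below : ∀ x h → 0 < PDfwd x h → x (h ∸ PDfwd x h) <ℤ x h
PDfwd-below x h pos with lastBelow x (x h) (h ∸ 1) in eq
... | just j with lastBelow-sound x (x h) (h ∸ 1) eq
...   | xj<xh , j≤h∸1 = subst (λ t → x t <ℤ x h) (sym (m∸[m∸n]≡n (≤-trans j≤h∸1 (m∸n≤m h 1)))) xj<xh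

PDbwd-below : ∀ m x h → 0 < PDbwd m x h → x (h + PDbwd m x h) <ℤ x h
PDbwd-below m x h pos with firstBelow x (x h) (suc h) (m ∸ h) in eq
... | just j with firstBelow-sound x (x h) (suc h) (m ∸ h) eq
...   | xj<xh , h<j = subst (λ t → x t <ℤ x h) (sym (m+[n∸m]≡n (<⇒≤ h<j))) xj<xh

BelowPair : (ℕ → ℤ) → ℕ → ℕ → Set
BelowPair x i j = x j <ℤ x i × x j <ℤ x (suc i)

PDfwd-τ : ∀ x i {j k} → suc (suc i) ≤ j → j ≤ k → BelowPair x i j → PDfwd x k ≡ PDfwd (τ x i) k
PDfwd-τ x i {j} {k} 2+i≤j j≤k (xj<xi , xj<x1+i) =
  PDfwd-cong x (τ x i) k (sym (τ-above x i (≤-trans 2+i≤j j≤k))) lastBelow-eq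
  where
  lastBelow-eq : lastBelow x (x k) (k ∸ 1) ≡ lastBelow (τ x i) (x k) (k ∸ 1)
  lastBelow-eq with sameSide⊎below (x k) xj<xi xj<x1+i
  ... | inj₁ same  = lastBelow-cong x (τ x i) (x k) (k ∸ 1) (λ q _ → τ-sameSide x i same q)
  ... | inj₂ xj<xk = lastBelow-hit x (τ x i) (x k) (k ∸ 1) j≤k∸1
    (λ q j<q _ → SameSide-≡ (sym (τ-above x i (≤-trans 2+i≤j (<⇒≤ j<q)))))
    xj<xk (subst (_<ℤ x k) (sym (τ-above x i 2+i≤j)) xj<xk)
    where
    j≤k∸1 : j ≤ k ∸ 1
    j≤k∸1 = <⇒≤pred (≤∧≢⇒< j≤k (λ j≡k → <ℤ-irrefl (cong x j≡k) xj<xk))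

PDbwd-τ : ∀ m x i {j k} → k ≤ j → j < i → BelowPair x i j → PDbwd m x k ≡ PDbwd m (τ x i) k
PDbwd-τ m x i {j} {k} k≤j j<i (xj<xi , xj<x1+i) =
  PDbwd-cong m x (τ x i) k (sym (τ-below x i (≤-<-trans k≤j j<i))) firstBelow-eq
  where
  firstBelow-eq : firstBelow x (x k) (suc k) (m ∸ k) ≡ firstBelow (τ x i) (x k) (suc k) (m ∸ k)
  firstBelow-eq with sameSide⊎below (x k) xj<xi xj<x1+i
  ... | inj₁ same  = firstBelow-cong x (τ x i) (x k) (suc k) (m ∸ k) (λ q _ → τ-sameSide x i same q)
  ... | inj₂ xj<xk = firstBelow-hit x (τ x i) (x k) (suc k) (m ∸ k) k<j
    (λ q _ q<j → SameSide-≡ (sym (τ-below x i (<-trans q<j j<i))))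
    xj<xk (subst (_<ℤ x k) (sym (τ-below x i j<i)) xj<xk)
    where
    k<j : k < j
    k<j = ≤∧≢⇒< k≤j (λ k≡j → <ℤ-irrefl (cong x (sym k≡j)) xj<xk)

m+[n∸m+1]≡1+n : ∀ {m n} → m ≤ n → m + (n ∸ m + 1) ≡ suc n
m+[n∸m+1]≡1+n {m} {n} m≤n = begin
  m + (n ∸ m + 1)   ≡⟨ cong (m +_) (+-comm (n ∸ m) 1) ⟩
  m + suc (n ∸ m)   ≡⟨ +-suc m (n ∸ m) ⟩
  suc (m + (n ∸ m)) ≡⟨ cong suc (m+[n∸m]≡n m≤n) ⟩
  suc n             ∎
  where open ≡-Reasoning

m∸[n∸1]≡[1+m]∸n : ∀ m n → 0 < n → m ∸ (n ∸ 1) ≡ suc m ∸ n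
m∸[n∸1]≡[1+m]∸n m (suc n) _ = refl

rOf-spec : ∀ m x i → i ≤ m →
  i + rOf m x i ≡ suc m ⊎ (suc (suc i) ≤ i + rOf m x i × BelowPair x i (i + rOf m x i))
rOf-spec m x i i≤m with x i <ℤ? x (suc i)
... | yes xi<x1+i with 1 ℕ.<? PDbwd m x i
...   | yes 1<d = inj₂ (≤-trans (≤-reflexive (+-comm 2 i)) (+-monoʳ-≤ i 1<d) , below , <ℤ-trans below xi<x1+i)
  where below = PDbwd-below m x i (<-trans z<s 1<d)
...   | no _ = inj₁ (m+[n∸m+1]≡1+n i≤m)
rOf-spec m x i i≤m | no _ with x (suc i) <ℤ? x i | 0 ℕ.<? PDbwd m x (suc i)
... | yes x1+i<xi | yes 0<d = inj₂ (subst (λ j → suc (suc i) ≤ j × BelowPair x i j) (sym shift)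
                                      (s≤s (m<m+n i 0<d) , <ℤ-trans below x1+i<xi , below))
  where
  d = PDbwd m x (suc i)
  below = PDbwd-below m x (suc i) 0<d
  shift : i + (d + 1) ≡ suc i + d
  shift = trans (sym (+-assoc i d 1)) (+-comm (i + d) 1)
... | yes _ | no _ = inj₁ (m+[n∸m+1]≡1+n i≤m)
... | no _  | _    = inj₁ (m+[n∸m+1]≡1+n i≤m)

ℓOf-spec : ∀ x i → 0 < i → i ∸ ℓOf x i ≡ 0 ⊎ (i ∸ ℓOf x i < i × BelowPair x i (i ∸ ℓOf x i))
ℓOf-spec x i 0<i with x i <ℤ? x (suc i)
... | yes xi<x1+i with 0 ℕ.<? PDfwd x i
...   | yes 0<d = inj₂ (m∸n<m i (PDfwd x i) 0<i 0<d , below , <ℤ-trans below xi<x1+i)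
  where below = PDfwd-below x i 0<d
...   | no _ = inj₁ (n∸n≡0 i)
ℓOf-spec x i 0<i | no _ with x (suc i) <ℤ? x i | 1 ℕ.<? PDfwd x (suc i)
... | yes x1+i<xi | yes 1<d = inj₂ (m∸n<m i (d ∸ 1) 0<i (∸-monoˡ-< 1<d ≤-refl) ,
                                    subst (BelowPair x i) (sym shift) (<ℤ-trans below x1+i<xi , below))
  where
  d = PDfwd x (suc i)
  0<d = <-trans z<s 1<d
  below = PDfwd-below x (suc i) 0<d
  shift : i ∸ (d ∸ 1) ≡ suc i ∸ d
  shift = m∸[n∸1]≡[1+m]∸n i d 0<d
... | yes _ | no _ = inj₁ (n∸n≡0 i)
... | no _  | _    = inj₁ (n∸n≡0 i)

lemma9 : (m : ℕ) (x : ℕ → ℤ) (i : ℕ) → Distinct m x → 1 ≤ i → i ≤ m ∸ 1 →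
    ((k : ℕ) → i + rOf m x i ≤ k → k ≤ m → PDfwd x k ≡ PDfwd (τ x i) k)
    × ((k : ℕ) → 1 ≤ k → k ≤ i ∸ ℓOf x i → PDbwd m x k ≡ PDbwd m (τ x i) k)
lemma9 m x i _ 1≤i i≤m∸1 = forward , backward
  where
  forward : ∀ k → i + rOf m x i ≤ k → k ≤ m → PDfwd x k ≡ PDfwd (τ x i) k
  forward k i+r≤k k≤m with rOf-spec m x i (≤-trans i≤m∸1 (m∸n≤m m 1))
  ... | inj₁ i+r≡1+m = contradiction (≤-trans (≤-trans (≤-reflexive (sym i+r≡1+m)) i+r≤k) k≤m) (n≮n m)
  ... | inj₂ (2+i≤i+r , below) = PDfwd-τ x i 2+i≤i+r i+r≤k below

  backward : ∀ k → 1 ≤ k → k ≤ i ∸ ℓOf x i → PDbwd m x k ≡ PDbwd m (τ x i) k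
  backward k 1≤k k≤i∸ℓ with ℓOf-spec x i 1≤i
  ... | inj₁ i∸ℓ≡0 = contradiction (≤-trans 1≤k (≤-trans k≤i∸ℓ (≤-reflexive i∸ℓ≡0))) n≮0
  ... | inj₂ (i∸ℓ<i , below) = PDbwd-τ m x i k≤i∸ℓ i∸ℓ<i below
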